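{- Let $x\geq 3$ be an odd integer and let $y\in\{1,2\}$. There exists a $(\mathbb Z_2^{x-1}\times\mathbb Z_{2^y}\times\mathbb Z_3^2,\{2^{2^x-1},3^2\},3,1)$-difference family.
   Context: Let $(G,+)$ be a finite abelian group. A partial spread of $G$ is a family $\Sigma$ of subgroups of $G$ whose members pairwise intersect trivially; it has type $\{n_1^{f_1},\dots,n_t^{f_t}\}$ if it consists of exactly $f_i$ subgroups of order $n_i$ for each $i$ (and no others). For a triple $T=\{a,b,c\}$ of three distinct elements of $G$, $\Delta T$ is the multiset $\{\pm(a-b),\pm(a-c),\pm(b-c)\}$, and for a set $\mathcal T$ of triples, $\Delta\mathcal T$ is the multiset union of the $\Delta T$. For a partial spread $\Sigma$, a $(G,\Sigma,3,1)$-difference family is a set $\mathcal T$ of triples of $G$ with $\Delta\mathcal T=G\setminus\bigcup_{S\in\Sigma}S$ as multisets (each element outside the union occurs exactly once, elements of the union do not occur). A $(G,\tau,3,1)$-difference family is a $(G,\Sigma,3,1)$-difference family for some partial spread $\Sigma$ of $G$ of type $\tau$. -}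

module Defs where

open import Data.Nat using (ℕ; zero; suc; _+_; _∸_; _^_)
open import Data.Nat.DivMod using (_mod_)
open import Data.Fin using (Fin; toℕ) renaming (_≟_ to _≟F_)
import Data.Fin as F
open import Data.Unit using (⊤; tt)
open import Data.Product using (Σ; _×_; _,_; ∃)
open import Data.Product.Properties using (≡-dec)
open import Data.List using (List; []; _∷_; _++_; length; filter; concat; concatMap; replicate)
open import Data.List.Membership.Propositional using (_∈_)
open import Data.List.Relation.Unary.All using (All)
open import Data.List.Relation.Unary.AllPairs using (AllPairs)
open import Data.List.Relation.Unary.Unique.Propositional using (Unique)
open import Data.List.Relation.Binary.Pointwise using (Pointwise)
open import Relation.Binary.PropositionalEquality using (_≡_; refl)
open import Relation.Binary.Definitions using (DecidableEquality)
open import Relation.Nullary using (¬_; yes; no)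

-- CONVENTION: a list ms = m₁ ∷ ... ∷ m_k of *predecessors* of the
-- cyclic moduli; the factor for entry m is Z_{suc m} = Fin (suc m)
-- with addition modulo suc m.

Elem : List ℕ → Set
Elem []       = ⊤
Elem (m ∷ ms) = Fin (suc m) × Elem ms

0E : ∀ {ms} → Elem ms
0E {[]}     = tt
0E {m ∷ ms} = F.zero , 0E

infixl 6 _+E_ _-E_

_+E_ : ∀ {ms} → Elem ms → Elem ms → Elem ms
_+E_ {[]}     _       _       = tt
_+E_ {m ∷ ms} (a , u) (b , v) = ((toℕ a + toℕ b) mod suc m) , (u +E v)

-E_ : ∀ {ms} → Elem ms → Elem ms
-E_ {[]}     _       = tt
-E_ {m ∷ ms} (a , u) = ((suc m ∸ toℕ a) mod suc m) , (-E u)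

_-E_ : ∀ {ms} → Elem ms → Elem ms → Elem ms
a -E b = a +E (-E b)

_≟E_ : ∀ {ms} → DecidableEquality (Elem ms)
_≟E_ {[]}     tt tt = yes refl
_≟E_ {m ∷ ms} = ≡-dec _≟F_ _≟E_

-- Subgroups, represented by a duplicate-free list of their elements.
-- The order of the subgroup is the length of the list.

record IsSubgroupList {ms : List ℕ} (S : List (Elem ms)) : Set where
  field
    unique  : Unique S
    has-0   : 0E ∈ S
    closed  : ∀ a b → a ∈ S → b ∈ S → (a -E b) ∈ S

TrivialIntersection : ∀ {ms} → List (Elem ms) → List (Elem ms) → Set
TrivialIntersection S T = ∀ g → g ∈ S → g ∈ T → g ≡ 0E

-- A type {n₁^{f₁},…,n_t^{f_t}} is a list of pairs (nᵢ , fᵢ).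
SpreadType : Set
SpreadType = List (ℕ × ℕ)

record PartialSpreadOfType {ms : List ℕ} (τ : SpreadType)
                           (Sp : List (List (Elem ms))) : Set where
  field
    blocks      : List (List (List (Elem ms)))
    is-concat   : Sp ≡ concat blocks
    block-type  : Pointwise (λ nf B →
                     (length B ≡ Data.Product.proj₂ nf) ×
                     All (λ S → length S ≡ Data.Product.proj₁ nf) B) τ blocks
    subgroups   : All IsSubgroupList Sp
    pairwise    : AllPairs TrivialIntersection Sp

Triple : List ℕ → Set
Triple ms = Elem ms × Elem ms × Elem ms

Distinct3 : ∀ {ms} → Triple ms → Set
Distinct3 (a , b , c) = ¬ a ≡ b × ¬ a ≡ c × ¬ b ≡ c

ΔT : ∀ {ms} → Triple ms → List (Elem ms)
ΔT (a , b , c) = (a -E b) ∷ (b -E a) ∷ (a -E c) ∷ (c -E a) ∷ (b -E c) ∷ (c -E b) ∷ []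

Δ : ∀ {ms} → List (Triple ms) → List (Elem ms)
Δ = concatMap ΔT

mult : ∀ {ms} → Elem ms → List (Elem ms) → ℕ
mult g l = length (filter (g ≟E_) l)

InUnion : ∀ {ms} → Elem ms → List (List (Elem ms)) → Set
InUnion g Sp = ∃ λ S → S ∈ Sp × g ∈ S

record IsDifferenceFamily {ms : List ℕ} (Sp : List (List (Elem ms)))
                          (Ts : List (Triple ms)) : Set where
  field
    distinct  : All Distinct3 Ts
    in-union  : ∀ g → InUnion g Sp → mult g (Δ Ts) ≡ 0
    outside   : ∀ g → ¬ InUnion g Sp → mult g (Δ Ts) ≡ 1

HasDF : (ms : List ℕ) → SpreadType → Set
HasDF ms τ = Σ (List (List (Elem ms))) λ Sp → Σ (List (Triple ms)) λ Ts →
               PartialSpreadOfType τ Sp × IsDifferenceFamily Sp Ts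

-- G(x,y) = Z_2^{x-1} × Z_{2^y} × Z_3 × Z_3  (predecessor encoding)
G : ℕ → ℕ → List ℕ
G x y = replicate (x ∸ 1) 1 ++ ((2 ^ y) ∸ 1) ∷ 2 ∷ 2 ∷ []

{-# OPTIONS --safe #-}
module Submission where

-- Call a list of triples of H an exact cover if its differences, together with the union of the
-- spread formed by the subgroups {0, u} (u an involution) and two subgroups ⟨s⟩, ⟨t⟩ of order 3
-- (0 counted once), list every element of H exactly once. An exact cover of H yields one of
-- Z₂² × H: each triple {a, b, c} lifts to four triples whose differences with any fixed label
-- v ∈ Z₂² are those of {a, b, c}; the triple {0, (1,0,s), (0,1,2s)} has the differences (v, ±s)
-- for v ≠ 0, which together with (0,0,±s) take the place of ⟨s⟩ (likewise for t); and the
-- involutions of Z₂² × H are the nonzero elements of Z₂² × H[2]. Iterating this from explicit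
-- exact covers of Z₂ × Z₃² and Z₂² × Z₄ × Z₃² reaches Z₂^{x-1} × Z_{2^y} × Z₃² for every odd x.

open import Defs
open import Data.Bool using (if_then_else_)
open import Data.Empty using (⊥-elim)
open import Data.Fin using (Fin; toℕ) renaming (_≟_ to _≟F_)
import Data.Fin as F
open import Data.Fin.Properties using (toℕ-fromℕ<; toℕ-injective; toℕ<n)
open import Data.List using (List; []; _∷_; _++_; map; length; filter; concatMap; drop; allFin; cartesianProduct)
open import Data.List.Properties using (filter-++; length-++; length-map; concatMap-++; filter-some; filter-none)
open import Data.List.Membership.Propositional using (_∈_; _∉_)
open import Data.List.Membership.Propositional.Properties using (∈-++⁺ˡ; ∈-++⁺ʳ; ∈-map⁺; ∈-cartesianProduct⁺; ∈-allFin)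
open import Data.List.Relation.Binary.Permutation.Propositional using (_↭_; ↭-refl; ↭-reflexive; ↭-swap; ↭-trans)
open import Data.List.Relation.Binary.Permutation.Propositional.Properties using (↭-length; filter-↭; ++⁺ˡ; ++-comm; shifts)
open import Data.List.Relation.Binary.Pointwise using (_∷_; [])
open import Data.List.Relation.Binary.Subset.Propositional using (_⊆_)
open import Data.List.Relation.Unary.All as All using (All; []; _∷_; all?)
import Data.List.Relation.Unary.All.Properties as All
open import Data.List.Relation.Unary.AllPairs as AllPairs using (AllPairs; []; _∷_)
import Data.List.Relation.Unary.AllPairs.Properties as AllPairs
open import Data.List.Relation.Unary.Any using (here; there)
open import Data.List.Relation.Unary.Unique.Propositional using (Unique)
open import Data.Nat using (ℕ; zero; suc; _+_; _*_; _∸_; _^_; _≤_; _%_; NonZero; s≤s) renaming (_≟_ to _≟ℕ_)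
open import Data.Nat.DivMod using (_mod_; n%n≡0; m<n⇒m%n≡m; %-distribˡ-+; m%n%n≡m%n)
open import Data.Nat.Properties
  using (suc-injective; +-identityʳ; +-comm; *-suc; m+[n∸m]≡n; <⇒≤; ≤-trans; ≤-reflexive; m≤m+n; m≤n+m; +-mono-≤; m+n≡0⇒n≡0)
open import Data.Product using (Σ; _,_; proj₂)
open import Data.Sum using (_⊎_; inj₁; inj₂)
open import Data.Unit using (tt)
open import Function using (_∘_)
open import Function.Definitions using (Injective)
open import Relation.Binary.PropositionalEquality
open import Relation.Nullary using (Dec; yes; no; does; ¬?; contradiction)
open import Relation.Nullary.Decidable using (True; toWitness; map′; _×-dec_)

pattern 0₂ = F.zero
pattern 1₂ = F.suc F.zero

[m+n%d]%d≡[m+n]%d : ∀ m n d .{{_ : NonZero d}} → (m + n % d) % d ≡ (m + n) % d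
[m+n%d]%d≡[m+n]%d m n d = begin
  (m + n % d) % d          ≡⟨ %-distribˡ-+ m (n % d) d ⟩
  (m % d + n % d % d) % d  ≡⟨ cong (λ k → (m % d + k) % d) (m%n%n≡m%n n d) ⟩
  (m % d + n % d) % d      ≡⟨ %-distribˡ-+ m n d ⟨
  (m + n) % d              ∎
  where open ≡-Reasoning

module _ {m : ℕ} (a : Fin (suc m)) where
  private
    n = suc m

  a-0≡a : (toℕ a + toℕ ((n ∸ 0) mod n)) mod n ≡ a
  a-0≡a = toℕ-injective (begin
    toℕ ((toℕ a + toℕ (n mod n)) mod n)  ≡⟨ toℕ-fromℕ< _ ⟩
    (toℕ a + toℕ (n mod n)) % n          ≡⟨ cong (λ k → (toℕ a + k) % n) (trans (toℕ-fromℕ< _) (n%n≡0 n)) ⟩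
    (toℕ a + 0) % n                      ≡⟨ cong (_% n) (+-identityʳ (toℕ a)) ⟩
    toℕ a % n                            ≡⟨ m<n⇒m%n≡m (toℕ<n a) ⟩
    toℕ a                                ∎)
    where open ≡-Reasoning

  a-a≡0 : (toℕ a + toℕ ((n ∸ toℕ a) mod n)) mod n ≡ F.zero
  a-a≡0 = toℕ-injective (begin
    toℕ ((toℕ a + toℕ ((n ∸ toℕ a) mod n)) mod n)  ≡⟨ toℕ-fromℕ< _ ⟩
    (toℕ a + toℕ ((n ∸ toℕ a) mod n)) % n          ≡⟨ cong (λ k → (toℕ a + k) % n) (toℕ-fromℕ< _) ⟩
    (toℕ a + (n ∸ toℕ a) % n) % n                  ≡⟨ [m+n%d]%d≡[m+n]%d (toℕ a) (n ∸ toℕ a) n ⟩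
    (toℕ a + (n ∸ toℕ a)) % n                      ≡⟨ cong (_% n) (m+[n∸m]≡n (<⇒≤ (toℕ<n a))) ⟩
    n % n                                          ≡⟨ n%n≡0 n ⟩
    0                                              ∎)
    where open ≡-Reasoning

-E-identityʳ : ∀ {ms} (g : Elem ms) → g -E 0E ≡ g
-E-identityʳ {[]}    _       = refl
-E-identityʳ {_ ∷ _} (a , g) = cong₂ _,_ (a-0≡a a) (-E-identityʳ g)

-E-self : ∀ {ms} (g : Elem ms) → g -E g ≡ 0E
-E-self {[]}    _       = refl
-E-self {_ ∷ _} (a , g) = cong₂ _,_ (a-a≡0 a) (-E-self g)

mult-++ : ∀ {ms} (g : Elem ms) xs ys → mult g (xs ++ ys) ≡ mult g xs + mult g ys
mult-++ g xs ys = trans (cong length (filter-++ (g ≟E_) xs ys)) (length-++ (filter (g ≟E_) xs))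

mult-++₄ : ∀ {ms} (g : Elem ms) ws xs ys zs →
           mult g (ws ++ xs ++ ys ++ zs) ≡ mult g ws + (mult g xs + (mult g ys + mult g zs))
mult-++₄ g ws xs ys zs =
  trans (mult-++ g ws _) (cong (mult g ws +_) (trans (mult-++ g xs _) (cong (mult g xs +_) (mult-++ g ys zs))))

mult-↭ : ∀ {ms} (g : Elem ms) {xs ys} → xs ↭ ys → mult g xs ≡ mult g ys
mult-↭ g p = ↭-length (filter-↭ (g ≟E_) p)

mult-map : ∀ {ms ms′} {f : Elem ms → Elem ms′} → Injective _≡_ _≡_ f → ∀ g xs → mult (f g) (map f xs) ≡ mult g xs
mult-map         inj g []       = refl
mult-map {f = f} inj g (h ∷ xs) with g ≟E h | f g ≟E f h
... | yes refl | yes _  = cong suc (mult-map inj g xs)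
... | yes refl | no ne  = ⊥-elim (ne refl)
... | no ne    | yes e  = ⊥-elim (ne (inj e))
... | no _     | no _   = mult-map inj g xs

mult-map-∉ : ∀ {ms ms′} {f : Elem ms → Elem ms′} {y} → (∀ h → y ≢ f h) → ∀ xs → mult y (map f xs) ≡ 0
mult-map-∉             y∉ []       = refl
mult-map-∉ {f = f} {y} y∉ (h ∷ xs) with y ≟E f h
... | yes e = ⊥-elim (y∉ h e)
... | no _  = mult-map-∉ y∉ xs

module _ {ms : List ℕ} where

  mult-∈ : ∀ {g : Elem ms} {xs} → g ∈ xs → 1 ≤ mult g xs
  mult-∈ {g} = filter-some (g ≟E_)

  mult-∉ : ∀ {g : Elem ms} {xs} → g ∉ xs → mult g xs ≡ 0
  mult-∉ {g} {xs} g∉xs = cong length (filter-none (g ≟E_) (All.¬Any⇒All¬ xs g∉xs))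

  mult≤1⇒Unique : ∀ {xs : List (Elem ms)} → (∀ g → mult g xs ≤ 1) → Unique xs
  mult≤1⇒Unique {[]}     _      = []
  mult≤1⇒Unique {x ∷ xs} mult≤1 = All.tabulate x∉xs ∷ mult≤1⇒Unique (λ g → ≤-trans (m≤n+m _ _) (split≤1 g))
    where
    split≤1 : ∀ g → mult g (x ∷ []) + mult g xs ≤ 1
    split≤1 g = ≤-trans (≤-reflexive (sym (mult-++ g (x ∷ []) xs))) (mult≤1 g)
    x∉xs : ∀ {y} → y ∈ xs → x ≢ y
    x∉xs y∈xs refl with ≤-trans (+-mono-≤ (mult-∈ (here refl)) (mult-∈ y∈xs)) (split≤1 x)
    ... | s≤s ()

  mult-++-∈ˡ : ∀ {g : Elem ms} {xs ys} → g ∈ xs → mult g (xs ++ ys) ≡ 1 → mult g ys ≡ 0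
  mult-++-∈ˡ {g} {xs} {ys} g∈xs once = 1≤m⇒m+n≡1⇒n≡0 (mult-∈ g∈xs) (trans (sym (mult-++ g xs ys)) once)
    where
    1≤m⇒m+n≡1⇒n≡0 : ∀ {m n} → 1 ≤ m → m + n ≡ 1 → n ≡ 0
    1≤m⇒m+n≡1⇒n≡0 {suc m} _ m+n≡1 = m+n≡0⇒n≡0 m (suc-injective m+n≡1)

  mult-++-∉ˡ : ∀ {g : Elem ms} {xs ys} → g ∉ xs → mult g (xs ++ ys) ≡ 1 → mult g ys ≡ 1
  mult-++-∉ˡ {g} {xs} {ys} g∉xs once = trans (cong (_+ mult g ys) (sym (mult-∉ g∉xs))) (trans (sym (mult-++ g xs ys)) once)

slice : ∀ {m ms} → Fin (suc m) → List (Elem (m ∷ ms)) → List (Elem ms)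
slice a []             = []
slice a ((b , h) ∷ xs) = if does (a ≟F b) then h ∷ slice a xs else slice a xs

mult-slice : ∀ {m ms} a (g : Elem ms) (xs : List (Elem (m ∷ ms))) → mult (a , g) xs ≡ mult g (slice a xs)
mult-slice a g []             = refl
mult-slice a g ((b , h) ∷ xs) with a ≟F b
... | no _     = mult-slice a g xs
... | yes refl with g ≟E h
...   | yes _ = cong suc (mult-slice a g xs)
...   | no _  = mult-slice a g xs

mult-slice₂ : ∀ {ms} (a b : Fin 2) (g : Elem ms) xs → mult (a , b , g) xs ≡ mult g (slice b (slice a xs))
mult-slice₂ a b g xs = trans (mult-slice a (b , g) xs) (mult-slice b g (slice a xs))

-- Spreads of involutions and two subgroups of order 3

module _ {ms : List ℕ} where

  TwoTorsion : Elem ms → Set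
  TwoTorsion u = 0E -E u ≡ u

  -- The subtraction table of {0, s, s + s}; in a group it amounts to 3s = 0.
  record ThreeTorsion (s : Elem ms) : Set where
    field
      0-s  : 0E -E s ≡ s +E s
      0-2s : 0E -E (s +E s) ≡ s
      s-2s : s -E (s +E s) ≡ s +E s
      2s-s : (s +E s) -E s ≡ s

  ⟨_⟩₂ : Elem ms → List (Elem ms)
  ⟨ u ⟩₂ = 0E ∷ u ∷ []

  ⟨_⟩₃* : Elem ms → List (Elem ms)
  ⟨ s ⟩₃* = s ∷ s +E s ∷ []

  ⟨_⟩₃ : Elem ms → List (Elem ms)
  ⟨ s ⟩₃ = 0E ∷ ⟨ s ⟩₃*

  spreadUnion : Elem ms → Elem ms → List (Elem ms) → List (Elem ms)
  spreadUnion s t involutions = ⟨ s ⟩₃* ++ ⟨ t ⟩₃* ++ 0E ∷ involutions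

-- The spread is ⟨ u ⟩₂ (u ∈ involutions), ⟨ s ⟩₃ and ⟨ t ⟩₃. Besides the difference condition,
-- exact-cover yields the partial-spread condition, since it makes spreadUnion duplicate-free.
record SpreadDF (ms : List ℕ) (r : ℕ) : Set where
  field
    s t                   : Elem ms
    s-3-torsion           : ThreeTorsion s
    t-3-torsion           : ThreeTorsion t
    involutions           : List (Elem ms)
    involutions-2-torsion : All TwoTorsion involutions
    2-torsion-size        : length (0E ∷ involutions) ≡ 2 ^ r
    triples               : List (Triple ms)
    triples-distinct      : All Distinct3 triples
    exact-cover           : ∀ g → mult g (spreadUnion s t involutions ++ Δ triples) ≡ 1

module _ {ms : List ℕ} where

  ⟨⟩₂-subgroup : ∀ {u : Elem ms} → TwoTorsion u → 0E ≢ u → IsSubgroupList ⟨ u ⟩₂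
  ⟨⟩₂-subgroup {u} -u≡u 0≢u = record
    { unique = (0≢u ∷ []) ∷ [] ∷ []
    ; has-0  = here refl
    ; closed = closed
    }
    where
    closed : ∀ a b → a ∈ ⟨ u ⟩₂ → b ∈ ⟨ u ⟩₂ → a -E b ∈ ⟨ u ⟩₂
    closed _ _ (here refl)         (here refl)         = here (-E-self 0E)
    closed _ _ (here refl)         (there (here refl)) = there (here -u≡u)
    closed _ _ (there (here refl)) (here refl)         = there (here (-E-identityʳ u))
    closed _ _ (there (here refl)) (there (here refl)) = here (-E-self u)

  ⟨⟩₃-subgroup : ∀ {s : Elem ms} → ThreeTorsion s → Unique ⟨ s ⟩₃ → IsSubgroupList ⟨ s ⟩₃
  ⟨⟩₃-subgroup {s} σ unique = record
    { unique = unique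
    ; has-0  = here refl
    ; closed = closed
    }
    where
    open ThreeTorsion σ
    closed : ∀ a b → a ∈ ⟨ s ⟩₃ → b ∈ ⟨ s ⟩₃ → a -E b ∈ ⟨ s ⟩₃
    closed _ _ (here refl)                 (here refl)                 = here (-E-self 0E)
    closed _ _ (here refl)                 (there (here refl))         = there (there (here 0-s))
    closed _ _ (here refl)                 (there (there (here refl))) = there (here 0-2s)
    closed _ _ (there (here refl))         (here refl)                 = there (here (-E-identityʳ s))
    closed _ _ (there (here refl))         (there (here refl))         = here (-E-self s)
    closed _ _ (there (here refl))         (there (there (here refl))) = there (there (here s-2s))
    closed _ _ (there (there (here refl))) (here refl)                 = there (there (here (-E-identityʳ (s +E s))))
    closed _ _ (there (there (here refl))) (there (here refl))         = there (here 2s-s)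
    closed _ _ (there (there (here refl))) (there (there (here refl))) = here (-E-self (s +E s))

  trivialIntersection : ∀ {xs ys : List (Elem ms)} → All (λ x → All (x ≢_) ys) xs → TrivialIntersection (0E ∷ xs) (0E ∷ ys)
  trivialIntersection xs≢ys g (here g≡0)   _            = g≡0
  trivialIntersection xs≢ys g (there _)    (here g≡0)   = g≡0
  trivialIntersection xs≢ys g (there g∈xs) (there g∈ys) = ⊥-elim (All.lookup (All.lookup xs≢ys g∈xs) g∈ys refl)

SpreadDF⇒HasDF : ∀ {ms r} → SpreadDF ms r → HasDF ms ((2 , 2 ^ r ∸ 1) ∷ (3 , 2) ∷ [])
SpreadDF⇒HasDF {ms} {r} D = Σ₂ ++ Σ₃ , triples , isPartialSpread , isDifferenceFamily
  where
  open SpreadDF D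
  union = spreadUnion s t involutions
  Σ₂ = map ⟨_⟩₂ involutions
  Σ₃ = ⟨ s ⟩₃ ∷ ⟨ t ⟩₃ ∷ []

  union-unique : Unique union
  union-unique = mult≤1⇒Unique λ g →
    ≤-trans (m≤m+n _ _) (≤-reflexive (trans (sym (mult-++ g union (Δ triples))) (exact-cover g)))

  subgroups : Unique union → All IsSubgroupList (Σ₂ ++ Σ₃)
  subgroups ((s≢2s ∷ _ ∷ _ ∷ s≢0 ∷ _) ∷ (_ ∷ _ ∷ 2s≢0 ∷ _) ∷ (t≢2t ∷ t≢0 ∷ _) ∷ (2t≢0 ∷ _) ∷ 0∉ ∷ _) =
    All.++⁺ (All.map⁺ (All.zipWith (λ (2-torsion , 0≢u) → ⟨⟩₂-subgroup 2-torsion 0≢u) (involutions-2-torsion , 0∉)))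
            ( ⟨⟩₃-subgroup s-3-torsion ((≢-sym s≢0 ∷ ≢-sym 2s≢0 ∷ []) ∷ (s≢2s ∷ []) ∷ [] ∷ [])
            ∷ ⟨⟩₃-subgroup t-3-torsion ((≢-sym t≢0 ∷ ≢-sym 2t≢0 ∷ []) ∷ (t≢2t ∷ []) ∷ [] ∷ []) ∷ [])

  pairwise : Unique union → AllPairs TrivialIntersection (Σ₂ ++ Σ₃)
  pairwise ((_ ∷ s≢t ∷ s≢2t ∷ _ ∷ s∉) ∷ (2s≢t ∷ 2s≢2t ∷ _ ∷ 2s∉) ∷ (_ ∷ _ ∷ t∉) ∷ (_ ∷ 2t∉) ∷ _ ∷ involutions-unique) =
    AllPairs.++⁺ (AllPairs.map⁺ (AllPairs.map (λ u≢v → trivialIntersection ((u≢v ∷ []) ∷ [])) involutions-unique))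
                 ((trivialIntersection ((s≢t ∷ s≢2t ∷ []) ∷ (2s≢t ∷ 2s≢2t ∷ []) ∷ []) ∷ []) ∷ [] ∷ [])
                 (All.map⁺ (All.tabulate λ u∈ →
                      trivialIntersection ((≢-sym (All.lookup s∉ u∈) ∷ ≢-sym (All.lookup 2s∉ u∈) ∷ []) ∷ [])
                    ∷ trivialIntersection ((≢-sym (All.lookup t∉ u∈) ∷ ≢-sym (All.lookup 2t∉ u∈) ∷ []) ∷ []) ∷ []))

  0∈union : 0E ∈ union
  0∈union = there (there (there (there (here refl))))

  spread⊆union : All (_⊆ union) (Σ₂ ++ Σ₃)
  spread⊆union = All.++⁺ (All.map⁺ (All.tabulate ⟨u⟩₂⊆union)) (⟨s⟩₃⊆union ∷ ⟨t⟩₃⊆union ∷ [])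
    where
    ⟨u⟩₂⊆union : ∀ {u} → u ∈ involutions → ⟨ u ⟩₂ ⊆ union
    ⟨u⟩₂⊆union u∈ (here refl)         = 0∈union
    ⟨u⟩₂⊆union u∈ (there (here refl)) = there (there (there (there (there u∈))))
    ⟨s⟩₃⊆union : ⟨ s ⟩₃ ⊆ union
    ⟨s⟩₃⊆union (here refl)                 = 0∈union
    ⟨s⟩₃⊆union (there (here refl))         = here refl
    ⟨s⟩₃⊆union (there (there (here refl))) = there (here refl)
    ⟨t⟩₃⊆union : ⟨ t ⟩₃ ⊆ union
    ⟨t⟩₃⊆union (here refl)                 = 0∈union
    ⟨t⟩₃⊆union (there (here refl))         = there (there (here refl))
    ⟨t⟩₃⊆union (there (there (here refl))) = there (there (there (here refl)))

  union⊆spread : ∀ {g} → g ∈ union → InUnion g (Σ₂ ++ Σ₃)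
  union⊆spread (here refl)                                 = ⟨ s ⟩₃ , ∈-++⁺ʳ Σ₂ (here refl) , there (here refl)
  union⊆spread (there (here refl))                         = ⟨ s ⟩₃ , ∈-++⁺ʳ Σ₂ (here refl) , there (there (here refl))
  union⊆spread (there (there (here refl)))                 = ⟨ t ⟩₃ , ∈-++⁺ʳ Σ₂ (there (here refl)) , there (here refl)
  union⊆spread (there (there (there (here refl))))         = ⟨ t ⟩₃ , ∈-++⁺ʳ Σ₂ (there (here refl)) , there (there (here refl))
  union⊆spread (there (there (there (there (here refl))))) = ⟨ s ⟩₃ , ∈-++⁺ʳ Σ₂ (here refl) , here refl
  union⊆spread (there (there (there (there (there u∈)))))  = ⟨ _ ⟩₂ , ∈-++⁺ˡ (∈-map⁺ ⟨_⟩₂ u∈) , there (here refl)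

  isPartialSpread : PartialSpreadOfType ((2 , 2 ^ r ∸ 1) ∷ (3 , 2) ∷ []) (Σ₂ ++ Σ₃)
  isPartialSpread = record
    { blocks     = Σ₂ ∷ Σ₃ ∷ []
    ; is-concat  = refl
    ; block-type = ( trans (length-map ⟨_⟩₂ involutions) (cong (_∸ 1) 2-torsion-size)
                   , All.map⁺ (All.universal (λ _ → refl) involutions))
                 ∷ (refl , refl ∷ refl ∷ []) ∷ []
    ; subgroups  = subgroups union-unique
    ; pairwise   = pairwise union-unique
    }

  isDifferenceFamily : IsDifferenceFamily (Σ₂ ++ Σ₃) triples
  isDifferenceFamily = record
    { distinct = triples-distinct
    ; in-union = λ g (S , S∈ , g∈S) → mult-++-∈ˡ (All.lookup spread⊆union S∈ g∈S) (exact-cover g)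
    ; outside  = λ g g∉ → mult-++-∉ˡ (g∉ ∘ union⊆spread) (exact-cover g)
    }

-- Doubling: from H to Z₂ × Z₂ × H

module _ {ms : List ℕ} where

  _◂_ : ∀ {m} → Fin (suc m) → List (Elem ms) → List (Elem (m ∷ ms))
  a ◂ xs = map (a ,_) xs

  Z₂× : List (Elem ms) → List (Elem (1 ∷ ms))
  Z₂× xs = 0₂ ◂ xs ++ 1₂ ◂ xs

  length-Z₂× : ∀ (xs : List (Elem ms)) → length (Z₂× xs) ≡ 2 * length xs
  length-Z₂× xs = begin
    length (0₂ ◂ xs ++ 1₂ ◂ xs)            ≡⟨ length-++ (0₂ ◂ xs) ⟩
    length (0₂ ◂ xs) + length (1₂ ◂ xs)    ≡⟨ cong₂ _+_ (length-map _ xs) (trans (length-map _ xs) (sym (+-identityʳ _))) ⟩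
    2 * length xs                          ∎
    where open ≡-Reasoning

  mult-Z₂× : ∀ a g (xs : List (Elem ms)) → mult (a , g) (Z₂× xs) ≡ mult g xs
  mult-Z₂× 0₂ g xs = begin
    mult (0₂ , g) (0₂ ◂ xs ++ 1₂ ◂ xs)                  ≡⟨ mult-++ (0₂ , g) (0₂ ◂ xs) _ ⟩
    mult (0₂ , g) (0₂ ◂ xs) + mult (0₂ , g) (1₂ ◂ xs)   ≡⟨ cong₂ _+_ (mult-map (λ { refl → refl }) g xs) (mult-map-∉ (λ _ ()) xs) ⟩
    mult g xs + 0                                       ≡⟨ +-identityʳ _ ⟩
    mult g xs                                           ∎
    where open ≡-Reasoning
  mult-Z₂× 1₂ g xs = begin
    mult (1₂ , g) (0₂ ◂ xs ++ 1₂ ◂ xs)                  ≡⟨ mult-++ (1₂ , g) (0₂ ◂ xs) _ ⟩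
    mult (1₂ , g) (0₂ ◂ xs) + mult (1₂ , g) (1₂ ◂ xs)   ≡⟨ cong₂ _+_ (mult-map-∉ (λ _ ()) xs) (mult-map (λ { refl → refl }) g xs) ⟩
    mult g xs                                           ∎
    where open ≡-Reasoning

  TwoTorsion-Z₂× : ∀ {xs : List (Elem ms)} → All TwoTorsion xs → All TwoTorsion (Z₂× xs)
  TwoTorsion-Z₂× us = All.++⁺ (All.map⁺ (All.map (cong (0₂ ,_)) us)) (All.map⁺ (All.map (cong (1₂ ,_)) us))

module _ {ms : List ℕ} where

  Z₂² : List (Elem ms) → List (Elem (1 ∷ 1 ∷ ms))
  Z₂² xs = Z₂× (Z₂× xs)

  mult-Z₂² : ∀ a b g (xs : List (Elem ms)) → mult (a , b , g) (Z₂² xs) ≡ mult g xs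
  mult-Z₂² a b g xs = trans (mult-Z₂× a (b , g) (Z₂× xs)) (mult-Z₂× b g xs)

  ι : Elem ms → Elem (1 ∷ 1 ∷ ms)
  ι h = 0₂ , 0₂ , h

  ι-ThreeTorsion : ∀ {s} → ThreeTorsion s → ThreeTorsion (ι s)
  ι-ThreeTorsion σ = record { 0-s = cong ι 0-s ; 0-2s = cong ι 0-2s ; s-2s = cong ι s-2s ; 2s-s = cong ι 2s-s }
    where open ThreeTorsion σ

  _±_ : Elem ms → Elem ms → List (Elem ms)
  a ± b = a -E b ∷ b -E a ∷ []

  liftTriple : Triple ms → List (Triple (1 ∷ 1 ∷ ms))
  liftTriple (a , b , c) =
    ((0₂ , 0₂ , a) , (0₂ , 0₂ , b) , (0₂ , 0₂ , c)) ∷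
    ((0₂ , 0₂ , a) , (1₂ , 0₂ , b) , (0₂ , 1₂ , c)) ∷
    ((0₂ , 0₂ , a) , (0₂ , 1₂ , b) , (1₂ , 1₂ , c)) ∷
    ((0₂ , 0₂ , a) , (1₂ , 1₂ , b) , (1₂ , 0₂ , c)) ∷ []

  cyclicTriple : Elem ms → Triple (1 ∷ 1 ∷ ms)
  cyclicTriple s = 0E , (1₂ , 0₂ , s) , (0₂ , 1₂ , s +E s)

  mult-Δ-liftTriple : ∀ a b g T → mult (a , b , g) (Δ (liftTriple T)) ≡ mult g (ΔT T)
  mult-Δ-liftTriple a b g T = trans (mult-slice₂ a b g (Δ (liftTriple T))) (mult-↭ g (slice-Δ-liftTriple a b T))
    where
    -- Each nonzero label meets a ± b, a ± c and b ± c once each, in the three triples of nonzero labels.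
    slice-Δ-liftTriple : ∀ a b T → slice b (slice a (Δ (liftTriple T))) ↭ ΔT T
    slice-Δ-liftTriple 0₂ 0₂ (x , y , z) = ↭-refl
    slice-Δ-liftTriple 1₂ 0₂ (x , y , z) = ++⁺ˡ (x ± y) (++-comm (y ± z) (x ± z))
    slice-Δ-liftTriple 0₂ 1₂ (x , y , z) = shifts (x ± z) (x ± y)
    slice-Δ-liftTriple 1₂ 1₂ (x , y , z) = ↭-trans (++-comm (y ± z) (x ± z ++ x ± y)) (shifts (x ± z) (x ± y))

  mult-Δ-liftTriples : ∀ a b g Ts → mult (a , b , g) (Δ (concatMap liftTriple Ts)) ≡ mult g (Δ Ts)
  mult-Δ-liftTriples a b g []       = refl
  mult-Δ-liftTriples a b g (T ∷ Ts) = begin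
    mult (a , b , g) (Δ (liftTriple T ++ concatMap liftTriple Ts))
      ≡⟨ cong (mult (a , b , g)) (concatMap-++ ΔT (liftTriple T) (concatMap liftTriple Ts)) ⟩
    mult (a , b , g) (Δ (liftTriple T) ++ Δ (concatMap liftTriple Ts))
      ≡⟨ mult-++ (a , b , g) (Δ (liftTriple T)) _ ⟩
    mult (a , b , g) (Δ (liftTriple T)) + mult (a , b , g) (Δ (concatMap liftTriple Ts))
      ≡⟨ cong₂ _+_ (mult-Δ-liftTriple a b g T) (mult-Δ-liftTriples a b g Ts) ⟩
    mult g (ΔT T) + mult g (Δ Ts)
      ≡⟨ mult-++ g (ΔT T) (Δ Ts) ⟨
    mult g (Δ (T ∷ Ts))
      ∎
    where open ≡-Reasoning

  mult-cyclicTriple : ∀ {s} → ThreeTorsion s → ∀ a b g →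
                      mult (a , b , g) (ΔT (cyclicTriple s) ++ ⟨ ι s ⟩₃*) ≡ mult g ⟨ s ⟩₃*
  mult-cyclicTriple {s} σ a b g =
    trans (mult-slice₂ a b g (ΔT (cyclicTriple s) ++ ⟨ ι s ⟩₃*)) (mult-↭ g (slice-cyclicTriple a b))
    where
    open ThreeTorsion σ
    swap : ∀ {x y} → x ≡ s +E s → y ≡ s → x ∷ y ∷ [] ↭ ⟨ s ⟩₃*
    swap refl refl = ↭-swap _ _ ↭-refl
    slice-cyclicTriple : ∀ a b → slice b (slice a (ΔT (cyclicTriple s) ++ ⟨ ι s ⟩₃*)) ↭ ⟨ s ⟩₃*
    slice-cyclicTriple 0₂ 0₂ = ↭-refl
    slice-cyclicTriple 1₂ 0₂ = swap 0-s (-E-identityʳ s)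
    slice-cyclicTriple 0₂ 1₂ = ↭-reflexive (cong₂ (λ x y → x ∷ y ∷ []) 0-2s (-E-identityʳ (s +E s)))
    slice-cyclicTriple 1₂ 1₂ = swap s-2s 2s-s

  liftTriples-distinct : ∀ {Ts : List (Triple ms)} → All Distinct3 Ts → All Distinct3 (concatMap liftTriple Ts)
  liftTriples-distinct = All.concat⁺ ∘ All.map⁺ ∘ All.map (λ d → lift d ∷ lift d ∷ lift d ∷ lift d ∷ [])
    where
    strip : Elem (1 ∷ 1 ∷ ms) → Elem ms
    strip = proj₂ ∘ proj₂
    lift : ∀ {a b c : Elem ms} {a₁ a₂ b₁ b₂ c₁ c₂ : Fin 2} →
           Distinct3 (a , b , c) → Distinct3 ((a₁ , a₂ , a) , (b₁ , b₂ , b) , (c₁ , c₂ , c))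
    lift (a≢b , a≢c , b≢c) = a≢b ∘ cong strip , a≢c ∘ cong strip , b≢c ∘ cong strip

Z₂²× : ∀ {ms r} → SpreadDF ms r → SpreadDF (1 ∷ 1 ∷ ms) (2 + r)
Z₂²× {ms} D = record
  { s                     = ι s
  ; t                     = ι t
  ; s-3-torsion           = ι-ThreeTorsion s-3-torsion
  ; t-3-torsion           = ι-ThreeTorsion t-3-torsion
  ; involutions           = drop 1 (Z₂² (0E ∷ involutions))  -- Z₂² (0E ∷ _) starts with 0E
  ; involutions-2-torsion = All.tail (TwoTorsion-Z₂× (TwoTorsion-Z₂× (-E-self 0E ∷ involutions-2-torsion)))
  ; 2-torsion-size        = trans (length-Z₂× (Z₂× (0E ∷ involutions)))
                              (cong (2 *_) (trans (length-Z₂× (0E ∷ involutions)) (cong (2 *_) 2-torsion-size)))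
  ; triples               = cyclicTriple s ∷ cyclicTriple t ∷ concatMap liftTriple triples
  ; triples-distinct      = ((λ ()) , (λ ()) , (λ ())) ∷ ((λ ()) , (λ ()) , (λ ())) ∷ liftTriples-distinct triples-distinct
  ; exact-cover           = exact-cover′
  }
  where
  open SpreadDF D
  exact-cover′ : ∀ g → mult g (spreadUnion (ι s) (ι t) (drop 1 (Z₂² (0E ∷ involutions))) ++
                               Δ (cyclicTriple s ∷ cyclicTriple t ∷ concatMap liftTriple triples)) ≡ 1
  exact-cover′ (a , b , g) = begin
    mult (a , b , g) (S ++ T ++ G₂ ++ A ++ B ++ C)
      ≡⟨ mult-↭ (a , b , g) (↭-trans (shifts (S ++ T ++ G₂) A) (++⁺ˡ A (++⁺ˡ S (shifts (T ++ G₂) B)))) ⟩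
    mult (a , b , g) ((A ++ S) ++ (B ++ T) ++ G₂ ++ C)
      ≡⟨ mult-++₄ (a , b , g) (A ++ S) (B ++ T) G₂ C ⟩
    mult (a , b , g) (A ++ S) + (mult (a , b , g) (B ++ T) + (mult (a , b , g) G₂ + mult (a , b , g) C))
      ≡⟨ cong₂ _+_ (mult-cyclicTriple s-3-torsion a b g) (cong₂ _+_ (mult-cyclicTriple t-3-torsion a b g)
           (cong₂ _+_ (mult-Z₂² a b g (0E ∷ involutions)) (mult-Δ-liftTriples a b g triples))) ⟩
    mult g ⟨ s ⟩₃* + (mult g ⟨ t ⟩₃* + (mult g (0E ∷ involutions) + mult g (Δ triples)))
      ≡⟨ mult-++₄ g ⟨ s ⟩₃* ⟨ t ⟩₃* (0E ∷ involutions) (Δ triples) ⟨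
    mult g (spreadUnion s t involutions ++ Δ triples)
      ≡⟨ exact-cover g ⟩
    1 ∎
    where
    open ≡-Reasoning
    S  = ⟨ ι s ⟩₃*
    T  = ⟨ ι t ⟩₃*
    G₂ = Z₂² (0E ∷ involutions)
    A  = ΔT (cyclicTriple s)
    B  = ΔT (cyclicTriple t)
    C  = Δ (concatMap liftTriple triples)

SpreadDF-G : ℕ → ℕ → Set
SpreadDF-G x y = SpreadDF (G x y) x

Z₂²ᵏ× : ∀ y k {x} → SpreadDF-G (suc x) y → SpreadDF-G (suc (2 * k + x)) y
Z₂²ᵏ× y zero        D = D
Z₂²ᵏ× y (suc k) {x} D =
  subst (λ j → SpreadDF-G (suc j) y) (cong (_+ x) (sym (*-suc 2 k))) (Z₂²× (Z₂²ᵏ× y k D))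

-- The two base families

elements : ∀ ms → List (Elem ms)
elements []       = tt ∷ []
elements (m ∷ ms) = cartesianProduct (allFin (suc m)) (elements ms)

∈-elements : ∀ {ms} (g : Elem ms) → g ∈ elements ms
∈-elements {[]}     tt      = here refl
∈-elements {m ∷ ms} (a , g) = ∈-cartesianProduct⁺ (∈-allFin a) (∈-elements g)

by-enumeration : ∀ {ms} {P : Elem ms → Set} → All P (elements ms) → ∀ g → P g
by-enumeration all-P g = All.lookup all-P (∈-elements g)

twoTorsion? : ∀ {ms} (u : Elem ms) → Dec (TwoTorsion u)
twoTorsion? u = (0E -E u) ≟E u

threeTorsion? : ∀ {ms} (s : Elem ms) → Dec (ThreeTorsion s)
threeTorsion? s = map′ (λ (e₁ , e₂ , e₃ , e₄) → record { 0-s = e₁ ; 0-2s = e₂ ; s-2s = e₃ ; 2s-s = e₄ })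
                       (λ σ → let open ThreeTorsion σ in 0-s , 0-2s , s-2s , 2s-s)
                       (  (0E -E s) ≟E (s +E s)      ×-dec (0E -E (s +E s)) ≟E s
                    ×-dec (s -E (s +E s)) ≟E (s +E s) ×-dec ((s +E s) -E s) ≟E s)

distinct3? : ∀ {ms} (T : Triple ms) → Dec (Distinct3 T)
distinct3? (a , b , c) = ¬? (a ≟E b) ×-dec ¬? (a ≟E c) ×-dec ¬? (b ≟E c)

exactCover? : ∀ {ms} (s t : Elem ms) involutions triples →
              Dec (All (λ g → mult g (spreadUnion s t involutions ++ Δ triples) ≡ 1) (elements ms))
exactCover? s t involutions triples = all? (λ g → mult g (spreadUnion s t involutions ++ Δ triples) ≟ℕ 1) _

spreadDF-by-computation : ∀ {ms} r (s t : Elem ms) involutions triples → length (0E ∷ involutions) ≡ 2 ^ r →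
  {True (threeTorsion? s ×-dec threeTorsion? t ×-dec all? twoTorsion? involutions ×-dec
         all? distinct3? triples ×-dec exactCover? s t involutions triples)} →
  SpreadDF ms r
spreadDF-by-computation r s t involutions triples size {checks} =
  let (σ , τ , 2-torsion , distinct , cover) = toWitness checks in record
    { s                     = s
    ; t                     = t
    ; s-3-torsion           = σ
    ; t-3-torsion           = τ
    ; involutions           = involutions
    ; involutions-2-torsion = 2-torsion
    ; 2-torsion-size        = size
    ; triples               = triples
    ; triples-distinct      = distinct
    ; exact-cover           = by-enumeration cover
    }

Z₂×Z₃² : SpreadDF-G 1 1
Z₂×Z₃² = spreadDF-by-computation 1 (el 0 1 0) (el 0 0 1) (el 1 0 0 ∷ [])
  (tri (el 0 1 1) (el 1 2 1) ∷ tri (el 0 1 2) (el 1 0 1) ∷ []) refl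
  where
  el : ℕ → ℕ → ℕ → Elem (G 1 1)
  el a b c = a mod 2 , b mod 3 , c mod 3 , tt
  tri : Elem (G 1 1) → Elem (G 1 1) → Triple (G 1 1)
  tri b c = 0E , b , c

Z₂²×Z₄×Z₃² : SpreadDF-G 3 2
Z₂²×Z₄×Z₃² = spreadDF-by-computation 3 (el 0 0 0 1 0) (el 0 0 0 0 1)
  (el 0 0 2 0 0 ∷ el 0 1 0 0 0 ∷ el 0 1 2 0 0 ∷ el 1 0 0 0 0 ∷ el 1 0 2 0 0 ∷ el 1 1 0 0 0 ∷ el 1 1 2 0 0 ∷ [])
  ( tri (el 0 0 0 1 1) (el 0 1 0 1 2) ∷ tri (el 0 0 0 1 2) (el 0 1 1 0 1) ∷ tri (el 0 0 1 0 0) (el 0 0 3 2 0)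
  ∷ tri (el 0 0 1 0 1) (el 1 0 0 0 2) ∷ tri (el 0 0 1 0 2) (el 0 1 3 1 2) ∷ tri (el 0 0 1 1 1) (el 1 1 1 1 0)
  ∷ tri (el 0 0 1 1 2) (el 1 0 0 2 1) ∷ tri (el 0 0 1 2 0) (el 1 0 2 0 2) ∷ tri (el 0 0 1 2 1) (el 1 1 1 1 2)
  ∷ tri (el 0 0 1 2 2) (el 1 0 2 1 1) ∷ tri (el 0 0 2 0 1) (el 1 1 2 1 1) ∷ tri (el 0 0 2 1 1) (el 1 1 3 1 2)
  ∷ tri (el 0 0 2 1 2) (el 0 1 3 2 0) ∷ tri (el 0 1 0 1 0) (el 1 1 2 0 1) ∷ tri (el 0 1 0 1 1) (el 1 0 3 0 0)
  ∷ tri (el 0 1 1 0 0) (el 1 0 3 1 0) ∷ tri (el 0 1 1 0 2) (el 1 0 0 1 0) ∷ tri (el 0 1 1 1 2) (el 1 1 1 2 0)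
  ∷ tri (el 0 1 1 2 0) (el 1 0 3 0 2) ∷ tri (el 0 1 2 0 1) (el 1 1 0 1 1) ∷ tri (el 0 1 2 1 1) (el 1 0 1 1 1)
  ∷ tri (el 0 1 2 1 2) (el 1 1 1 0 2) ∷ []) refl
  where
  el : ℕ → ℕ → ℕ → ℕ → ℕ → Elem (G 3 2)
  el a b c d e = a mod 2 , b mod 2 , c mod 4 , d mod 3 , e mod 3 , tt
  tri : Elem (G 3 2) → Elem (G 3 2) → Triple (G 3 2)
  tri b c = 0E , b , c

lemma3p14 : (x y : ℕ) → 3 ≤ x → Σ ℕ (λ k → x ≡ suc (2 * k)) → (y ≡ 1 ⊎ y ≡ 2) →
    HasDF (G x y) ((2 , (2 ^ x) ∸ 1) ∷ (3 , 2) ∷ [])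
lemma3p14 _ _ _   (k     , refl) (inj₁ refl) =
  SpreadDF⇒HasDF (subst (λ j → SpreadDF-G (suc j) 1) (+-identityʳ (2 * k)) (Z₂²ᵏ× 1 k Z₂×Z₃²))
lemma3p14 _ _ 3≤1 (zero  , refl) (inj₂ refl) = contradiction 3≤1 λ { (s≤s ()) }
lemma3p14 _ _ _   (suc k , refl) (inj₂ refl) =
  SpreadDF⇒HasDF (subst (λ j → SpreadDF-G (suc j) 2) (trans (+-comm (2 * k) 2) (sym (*-suc 2 k)))
                        (Z₂²ᵏ× 2 k Z₂²×Z₄×Z₃²))
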